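{- Let $G$ be a non-bipartite graph and let $i,n,s$ be positive integers with $is=n-1$. Then $$\chi_n\big(G^{\frac{1}{2s+1}}\big)\le 2n+i \iff \chi(G)\le \binom{2n+i}{n}.$$
   Context: For positive integers $m\ge 2n$, the Kneser graph $\mathrm{KG}(m,n)$ has as vertices the $n$-subsets of $\{1,\dots,m\}$, two being adjacent iff they are disjoint. The $n$th multichromatic number $\chi_n(H)$ of a graph $H$ is the smallest $m$ such that $H$ admits a homomorphism to $\mathrm{KG}(m,n)$, i.e. an assignment of $n$-subsets of $\{1,\dots,m\}$ to vertices with adjacent vertices receiving disjoint sets. $\chi(G)$ is the chromatic number. For a positive integer $t$, $G^{1/t}$ is the graph obtained from $G$ by replacing each edge by a path with $t$ edges. -}

module Defs where

open import Data.Nat using (ℕ; zero; suc; _+_; _*_; _∸_; _≤_; _<ᵇ_)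
open import Data.Bool using (Bool; true; false; _∧_; T)
open import Data.Fin using (Fin; toℕ)
open import Data.Fin.Subset using (Subset; _∩_; ∣_∣; Empty)
open import Data.Product using (Σ; _×_; _,_)
open import Data.Sum using (_⊎_)
open import Relation.Binary.PropositionalEquality using (_≡_; _≢_)
open import Relation.Nullary using (¬_)

record Graph : Set₁ where
  field
    V : Set
    E : V → V → Set

open Graph public

record FinGraph : Set where
  field
    N     : ℕ
    adj   : Fin N → Fin N → Bool
    sym   : ∀ u v → adj u v ≡ adj v u
    irref : ∀ v → adj v v ≡ false

open FinGraph public

toGraph : FinGraph → Graph
toGraph G = record { V = Fin (N G) ; E = λ u v → adj G u v ≡ true }

Hom : Graph → Graph → Set
Hom H K = Σ (V H → V K) λ f → ∀ x y → E H x y → E K (f x) (f y)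

Complete : ℕ → Graph
Complete k = record { V = Fin k ; E = λ a b → a ≢ b }

KG : ℕ → ℕ → Graph
KG m n = record
  { V = Σ (Subset m) (λ A → ∣ A ∣ ≡ n)
  ; E = λ A B → Empty (Data.Product.proj₁ A ∩ Data.Product.proj₁ B) }

ChromLe : Graph → ℕ → Set
ChromLe H k = Σ ℕ λ k' → k' ≤ k × Hom H (Complete k')

MultiChromLe : Graph → ℕ → ℕ → Set
MultiChromLe H n m = Σ ℕ λ m' → m' ≤ m × (n + n ≤ m') × Hom H (KG m' n)

NonBipartite : Graph → Set
NonBipartite H = ¬ Hom H (Complete 2)

-- Subdivision G^{1/t}: each edge {u,v} (listed once, with u < v) is replaced
-- by a path u = p_0, p_1, ..., p_{t-1}, p_t = v; the internal vertex p_{k+1}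
-- is  mid u v _ k  with k : Fin (t ∸ 1).
EdgeLt : (G : FinGraph) → Fin (N G) → Fin (N G) → Set
EdgeLt G u v = T (adj G u v ∧ (toℕ u <ᵇ toℕ v))

data SubV (G : FinGraph) (t : ℕ) : Set where
  orig : Fin (N G) → SubV G t
  mid  : (u v : Fin (N G)) → EdgeLt G u v → Fin (t ∸ 1) → SubV G t

data SubE (G : FinGraph) (t : ℕ) : SubV G t → SubV G t → Set where
  direct : ∀ u v (e : EdgeLt G u v) → t ≡ 1 → SubE G t (orig u) (orig v)
  start  : ∀ u v (e : EdgeLt G u v) (k : Fin (t ∸ 1)) → toℕ k ≡ 0 →
           SubE G t (orig u) (mid u v e k)
  step   : ∀ u v (e : EdgeLt G u v) (k k' : Fin (t ∸ 1)) → toℕ k' ≡ suc (toℕ k) →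
           SubE G t (mid u v e k) (mid u v e k')
  finish : ∀ u v (e : EdgeLt G u v) (k : Fin (t ∸ 1)) → suc (toℕ k) ≡ t ∸ 1 →
           SubE G t (mid u v e k) (orig v)

Subdiv : FinGraph → ℕ → Graph
Subdiv G t = record { V = SubV G t ; E = λ x y → SubE G t x y ⊎ SubE G t y x }

-- A homomorphism G^{1/(2s+1)} → KG(m,n) maps each subdivided edge onto a walk A = A₀, …, A_{2s+1} = B
-- in KG(m,n). In two steps A, X, A′ at most m − 2n elements of B can be lost, because X is disjoint
-- from A ∪ A′; hence |A ∩ B| + 2sn ≤ sm. For m ≤ 2n + i and is = n − 1 this forces A ≠ B, so the
-- images of the original vertices colour G properly by the C(m,n) n-subsets of [m].
-- Conversely, colour G by n-subsets of [2n + i]. Adjacent vertices get distinct sets, which share at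
-- most n − 1 = is elements. Exchanging i shared elements for elements outside A ∪ B, and passing
-- through an n-set outside both the old and the new set, lowers the overlap by i in two steps; after
-- s double steps the sets are disjoint, which gives a walk of length 2s + 1 for each subdivided edge.
module Submission where

open import Defs hiding (sym)
open import Data.Nat using (ℕ; zero; suc; _+_; _*_; _∸_; _≤_; _<_; _⊓_; z≤n; s≤s; _<?_; _≤′_; ≤′-refl; ≤′-step)
open import Data.Nat.Properties
open import Data.Nat.Combinatorics using (_C_; nCk+nC[k+1]≡[n+1]C[k+1])
open import Data.Bool using (true; false; T; _∧_)
open import Data.Empty using (⊥-elim)
open import Data.Fin using (Fin; zero; toℕ; fromℕ<; inject≤)
open import Data.Fin.Properties using (toℕ<n; toℕ-fromℕ<; toℕ-injective; inject≤-injective; +↔⊎)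
open import Data.Fin.Subset
open import Data.Fin.Subset.Properties
open import Data.Product using (Σ; _×_; _,_; proj₁; proj₂)
open import Data.Sum using (_⊎_; inj₁; inj₂; [_,_]′)
open import Data.Sum.Function.Propositional using (_⊎-↔_)
open import Data.Vec using (_∷_; []; here; there)
open import Function.Bundles using (Injection; _↔_; mk↔ₛ′; _⇔_; mk⇔)
open import Function.Properties.Inverse using (↔-refl; ↔-sym; ↔-trans; ↔⇒↣)
open import Relation.Binary using (tri<; tri≈; tri>)
open import Relation.Binary.PropositionalEquality
open import Relation.Nullary using (yes; no; contradiction)
open import Algebra.Properties.CommutativeSemigroup +-commutativeSemigroup using (xy∙z≈xz∙y)

private
  variable
    m : ℕ
    p p′ q q′ : Subset m

-- Disjoint subsets and cardinality

Disjoint : Subset m → Subset m → Set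
Disjoint p q = Empty (p ∩ q)

disjoint : (∀ {x} → x ∈ p → x ∉ q) → Disjoint p q
disjoint {p = p} {q} h (_ , x∈p∩q) = h (proj₁ (x∈p∩q⁻ p q x∈p∩q)) (proj₂ (x∈p∩q⁻ p q x∈p∩q))

disjoint⁻ : Disjoint p q → ∀ {x} → x ∈ p → x ∉ q
disjoint⁻ d x∈p x∈q = d (_ , x∈p∩q⁺ (x∈p , x∈q))

Disjoint-sym : Disjoint p q → Disjoint q p
Disjoint-sym d = disjoint λ x∈q x∈p → disjoint⁻ d x∈p x∈q

Disjoint-mono : p′ ⊆ p → q′ ⊆ q → Disjoint p q → Disjoint p′ q′
Disjoint-mono p′⊆p q′⊆q d = disjoint λ x∈p′ x∈q′ → disjoint⁻ d (p′⊆p x∈p′) (q′⊆q x∈q′)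

Disjoint-∪ : ∀ {m} {p q r : Subset m} → Disjoint p r → Disjoint q r → Disjoint (p ∪ q) r
Disjoint-∪ {p = p} {q = q} dp dq =
  disjoint λ x∈p∪q → [ disjoint⁻ dp , disjoint⁻ dq ]′ (x∈p∪q⁻ p q x∈p∪q)

Disjoint-∁ : Disjoint p (∁ p)
Disjoint-∁ = disjoint x∈p⇒x∉∁p

x∈p─q⇒x∉q : ∀ {m} {p q : Subset m} {x} → x ∈ p ─ q → x ∉ q
x∈p─q⇒x∉q {p = _ ∷ p} {q = outside ∷ q} (there x∈p─q) (there x∈q) = x∈p─q⇒x∉q x∈p─q x∈q
x∈p─q⇒x∉q {p = _ ∷ p} {q = inside ∷ q} (there x∈p─q) (there x∈q) = x∈p─q⇒x∉q x∈p─q x∈q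

Disjoint-─ : Disjoint (p ─ q) q
Disjoint-─ = disjoint x∈p─q⇒x∉q

∣p∪q∣+∣p∩q∣≡∣p∣+∣q∣ : ∀ (p q : Subset m) → ∣ p ∪ q ∣ + ∣ p ∩ q ∣ ≡ ∣ p ∣ + ∣ q ∣
∣p∪q∣+∣p∩q∣≡∣p∣+∣q∣ []            []            = refl
∣p∪q∣+∣p∩q∣≡∣p∣+∣q∣ (inside  ∷ p) (inside  ∷ q) =
  cong suc (trans (+-suc _ _) (trans (cong suc (∣p∪q∣+∣p∩q∣≡∣p∣+∣q∣ p q)) (sym (+-suc _ _))))
∣p∪q∣+∣p∩q∣≡∣p∣+∣q∣ (inside  ∷ p) (outside ∷ q) = cong suc (∣p∪q∣+∣p∩q∣≡∣p∣+∣q∣ p q)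
∣p∪q∣+∣p∩q∣≡∣p∣+∣q∣ (outside ∷ p) (inside  ∷ q) =
  trans (cong suc (∣p∪q∣+∣p∩q∣≡∣p∣+∣q∣ p q)) (sym (+-suc _ _))
∣p∪q∣+∣p∩q∣≡∣p∣+∣q∣ (outside ∷ p) (outside ∷ q) = ∣p∪q∣+∣p∩q∣≡∣p∣+∣q∣ p q

∣p∪q∣≤∣p∣+∣q∣ : ∀ (p q : Subset m) → ∣ p ∪ q ∣ ≤ ∣ p ∣ + ∣ q ∣
∣p∪q∣≤∣p∣+∣q∣ p q = subst (∣ p ∪ q ∣ ≤_) (∣p∪q∣+∣p∩q∣≡∣p∣+∣q∣ p q) (m≤m+n _ _)

Disjoint⇒∣p∩q∣≡0 : ∀ {m} {p q : Subset m} → Disjoint p q → ∣ p ∩ q ∣ ≡ 0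
Disjoint⇒∣p∩q∣≡0 {m} d = trans (cong ∣_∣ (Empty-unique d)) (∣⊥∣≡0 m)

Disjoint⇒∣p∪q∣≡∣p∣+∣q∣ : Disjoint p q → ∣ p ∪ q ∣ ≡ ∣ p ∣ + ∣ q ∣
Disjoint⇒∣p∪q∣≡∣p∣+∣q∣ {p = p} {q = q} d = begin
  ∣ p ∪ q ∣                ≡⟨ +-identityʳ _ ⟨
  ∣ p ∪ q ∣ + 0            ≡⟨ cong (∣ p ∪ q ∣ +_) (Disjoint⇒∣p∩q∣≡0 d) ⟨
  ∣ p ∪ q ∣ + ∣ p ∩ q ∣    ≡⟨ ∣p∪q∣+∣p∩q∣≡∣p∣+∣q∣ p q ⟩
  ∣ p ∣ + ∣ q ∣            ∎
  where open ≡-Reasoning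

Disjoint⇒∣p∣+∣q∣≤m : ∀ {m} {p q : Subset m} → Disjoint p q → ∣ p ∣ + ∣ q ∣ ≤ m
Disjoint⇒∣p∣+∣q∣≤m {p = p} {q = q} d =
  subst (_≤ _) (Disjoint⇒∣p∪q∣≡∣p∣+∣q∣ d) (∣p∣≤n (p ∪ q))

∣p∣≡0⇒Empty : ∀ {m} {p : Subset m} → ∣ p ∣ ≡ 0 → Empty p
∣p∣≡0⇒Empty {p = outside ∷ p} eq (_ , there x∈p) = ∣p∣≡0⇒Empty eq (_ , x∈p)

∣p─q∣+∣q∣≡∣p∣ : ∀ {m} {p q : Subset m} → q ⊆ p → ∣ p ─ q ∣ + ∣ q ∣ ≡ ∣ p ∣
∣p─q∣+∣q∣≡∣p∣ {p = []}          {[]}          _   = refl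
∣p─q∣+∣q∣≡∣p∣ {p = inside  ∷ p} {inside  ∷ q} q⊆p =
  trans (+-suc _ _) (cong suc (∣p─q∣+∣q∣≡∣p∣ (drop-∷-⊆ q⊆p)))
∣p─q∣+∣q∣≡∣p∣ {p = inside  ∷ p} {outside ∷ q} q⊆p = cong suc (∣p─q∣+∣q∣≡∣p∣ (drop-∷-⊆ q⊆p))
∣p─q∣+∣q∣≡∣p∣ {p = outside ∷ p} {inside  ∷ q} q⊆p = contradiction (q⊆p here) λ ()
∣p─q∣+∣q∣≡∣p∣ {p = outside ∷ p} {outside ∷ q} q⊆p = ∣p─q∣+∣q∣≡∣p∣ (drop-∷-⊆ q⊆p)

∣p∩q∣≡∣p∣⇒p⊆q : ∀ {m} {p q : Subset m} → ∣ p ∩ q ∣ ≡ ∣ p ∣ → p ⊆ q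
∣p∩q∣≡∣p∣⇒p⊆q {p = inside  ∷ p} {inside  ∷ q} eq here         = here
∣p∩q∣≡∣p∣⇒p⊆q {p = inside  ∷ p} {inside  ∷ q} eq (there x∈p) = there (∣p∩q∣≡∣p∣⇒p⊆q (suc-injective eq) x∈p)
∣p∩q∣≡∣p∣⇒p⊆q {p = inside  ∷ p} {outside ∷ q} eq _           =
  contradiction (subst (_≤ ∣ p ∣) eq (∣p∩q∣≤∣p∣ p q)) (n≮n ∣ p ∣)
∣p∩q∣≡∣p∣⇒p⊆q {p = outside ∷ p} {_       ∷ q} eq (there x∈p) = there (∣p∩q∣≡∣p∣⇒p⊆q eq x∈p)

∣p∣≡∣q∣∧p≢q⇒∣p∩q∣<∣p∣ : ∣ p ∣ ≡ ∣ q ∣ → p ≢ q → ∣ p ∩ q ∣ < ∣ p ∣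
∣p∣≡∣q∣∧p≢q⇒∣p∩q∣<∣p∣ {p = p} {q = q} ∣p∣≡∣q∣ p≢q = ≤∧≢⇒< (∣p∩q∣≤∣p∣ p q) λ full →
  p≢q (⊆-antisym (∣p∩q∣≡∣p∣⇒p⊆q full)
                 (∣p∩q∣≡∣p∣⇒p⊆q (trans (cong ∣_∣ (∩-comm q p)) (trans full ∣p∣≡∣q∣))))

subset-of-size : ∀ {m} (p : Subset m) {j} → j ≤ ∣ p ∣ → Σ (Subset m) λ q → q ⊆ p × ∣ q ∣ ≡ j
subset-of-size {m} p         {zero}  _           = ⊥ , ⊥⊆ , ∣⊥∣≡0 m
subset-of-size (inside  ∷ p) {suc j} (s≤s j≤∣p∣) with subset-of-size p j≤∣p∣
... | q , q⊆p , ∣q∣≡j = inside ∷ q , in⊆in q⊆p , cong suc ∣q∣≡j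
subset-of-size (outside ∷ p) {suc j} j≤∣p∣ with subset-of-size p j≤∣p∣
... | q , q⊆p , ∣q∣≡j = outside ∷ q , out⊆ q⊆p , ∣q∣≡j

disjoint-of-size : ∀ {m} (p : Subset m) {n} → n + ∣ p ∣ ≤ m → Σ (Subset m) λ x → ∣ x ∣ ≡ n × Disjoint p x
disjoint-of-size p {n} n+∣p∣≤m with subset-of-size (∁ p) n≤∣∁p∣
  where
  n≤∣∁p∣ : n ≤ ∣ ∁ p ∣
  n≤∣∁p∣ = subst (n ≤_) (sym (∣∁p∣≡n∸∣p∣ p)) (m+n≤o⇒m≤o∸n n n+∣p∣≤m)
... | x , x⊆∁p , ∣x∣≡n = x , ∣x∣≡n , Disjoint-mono ⊆-refl x⊆∁p Disjoint-∁

∣p∩r∣+∣x∣+∣q∣≤∣q∩r∣+m : ∀ {m} {p x q : Subset m} (r : Subset m) → Disjoint p x → Disjoint x q →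
                         ∣ p ∩ r ∣ + (∣ x ∣ + ∣ q ∣) ≤ ∣ q ∩ r ∣ + m
∣p∩r∣+∣x∣+∣q∣≤∣q∩r∣+m {m} {p} {x} {q} r p#x x#q = begin
  ∣ p ∩ r ∣ + (∣ x ∣ + ∣ q ∣)                  ≤⟨ +-monoˡ-≤ _ ∣p∩r∣≤∣q∩r∣+∣p─q∣ ⟩
  ∣ q ∩ r ∣ + ∣ p ─ q ∣ + (∣ x ∣ + ∣ q ∣)      ≡⟨ +-assoc ∣ q ∩ r ∣ _ _ ⟩
  ∣ q ∩ r ∣ + (∣ p ─ q ∣ + (∣ x ∣ + ∣ q ∣))    ≤⟨ +-monoʳ-≤ ∣ q ∩ r ∣ ∣p─q∣+∣x∣+∣q∣≤m ⟩
  ∣ q ∩ r ∣ + m                                ∎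
  where
  open ≤-Reasoning
  p∩r⊆q∩r∪p─q : p ∩ r ⊆ (q ∩ r) ∪ (p ─ q)
  p∩r⊆q∩r∪p─q {y} y∈p∩r with x∈p∩q⁻ p r y∈p∩r | y ∈? q
  ... | _   , y∈r | yes y∈q = p⊆p∪q (p ─ q) (x∈p∩q⁺ (y∈q , y∈r))
  ... | y∈p , _   | no  y∉q = q⊆p∪q (q ∩ r) (p ─ q) (x∈p∧x∉q⇒x∈p─q y∈p y∉q)
  ∣p∩r∣≤∣q∩r∣+∣p─q∣ : ∣ p ∩ r ∣ ≤ ∣ q ∩ r ∣ + ∣ p ─ q ∣
  ∣p∩r∣≤∣q∩r∣+∣p─q∣ = ≤-trans (p⊆q⇒∣p∣≤∣q∣ p∩r⊆q∩r∪p─q) (∣p∪q∣≤∣p∣+∣q∣ (q ∩ r) (p ─ q))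
  p─q#x∪q : Disjoint (p ─ q) (x ∪ q)
  p─q#x∪q = Disjoint-sym (Disjoint-∪ (Disjoint-mono ⊆-refl (p─q⊆p p q) (Disjoint-sym p#x))
                                     (Disjoint-sym Disjoint-─))
  ∣p─q∣+∣x∣+∣q∣≤m : ∣ p ─ q ∣ + (∣ x ∣ + ∣ q ∣) ≤ m
  ∣p─q∣+∣x∣+∣q∣≤m = subst (λ k → ∣ p ─ q ∣ + k ≤ m) (Disjoint⇒∣p∪q∣≡∣p∣+∣q∣ x#q)
                      (Disjoint⇒∣p∣+∣q∣≤m p─q#x∪q)

exchange : ∀ {m} (p q : Subset m) {r} → r ≤ ∣ p ∩ q ∣ → r ≤ ∣ ∁ (p ∪ q) ∣ →
           Σ (Subset m) λ p′ → ∣ p′ ∣ ≡ ∣ p ∣ × ∣ p ∪ p′ ∣ ≤ ∣ p ∣ + r × ∣ p′ ∩ q ∣ + r ≤ ∣ p ∩ q ∣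
exchange p q {r} r≤∣p∩q∣ r≤∣∁p∪q∣
  with subset-of-size (p ∩ q) r≤∣p∩q∣ | subset-of-size (∁ (p ∪ q)) r≤∣∁p∪q∣
... | R , R⊆p∩q , ∣R∣≡r | T , T⊆∁p∪q , ∣T∣≡r =
  (p ─ R) ∪ T , ∣p′∣≡∣p∣ , ∣p∪p′∣≤∣p∣+r , ∣p′∩q∣+r≤∣p∩q∣
  where
  p∪q#T : Disjoint (p ∪ q) T
  p∪q#T = Disjoint-mono ⊆-refl T⊆∁p∪q Disjoint-∁
  p─R#T : Disjoint (p ─ R) T
  p─R#T = Disjoint-mono (⊆-trans (p─q⊆p p R) (p⊆p∪q q)) ⊆-refl p∪q#T
  ∣p′∣≡∣p∣ : ∣ (p ─ R) ∪ T ∣ ≡ ∣ p ∣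
  ∣p′∣≡∣p∣ = begin
    ∣ (p ─ R) ∪ T ∣    ≡⟨ Disjoint⇒∣p∪q∣≡∣p∣+∣q∣ p─R#T ⟩
    ∣ p ─ R ∣ + ∣ T ∣  ≡⟨ cong (∣ p ─ R ∣ +_) (trans ∣T∣≡r (sym ∣R∣≡r)) ⟩
    ∣ p ─ R ∣ + ∣ R ∣  ≡⟨ ∣p─q∣+∣q∣≡∣p∣ (⊆-trans R⊆p∩q (p∩q⊆p p q)) ⟩
    ∣ p ∣              ∎
    where open ≡-Reasoning
  p∪p′⊆p∪T : p ∪ ((p ─ R) ∪ T) ⊆ p ∪ T
  p∪p′⊆p∪T {y} y∈ with x∈p∪q⁻ p _ y∈
  ... | inj₁ y∈p  = p⊆p∪q T y∈p
  ... | inj₂ y∈p′ with x∈p∪q⁻ (p ─ R) T y∈p′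
  ...   | inj₁ y∈p─R = p⊆p∪q T (p─q⊆p p R y∈p─R)
  ...   | inj₂ y∈T   = q⊆p∪q p T y∈T
  ∣p∪p′∣≤∣p∣+r : ∣ p ∪ ((p ─ R) ∪ T) ∣ ≤ ∣ p ∣ + r
  ∣p∪p′∣≤∣p∣+r = subst (λ k → ∣ p ∪ ((p ─ R) ∪ T) ∣ ≤ ∣ p ∣ + k) ∣T∣≡r
                   (≤-trans (p⊆q⇒∣p∣≤∣q∣ p∪p′⊆p∪T) (∣p∪q∣≤∣p∣+∣q∣ p T))
  p′∩q⊆p∩q─R : ((p ─ R) ∪ T) ∩ q ⊆ (p ∩ q) ─ R
  p′∩q⊆p∩q─R {y} y∈ with x∈p∩q⁻ ((p ─ R) ∪ T) q y∈
  ... | y∈p′ , y∈q with x∈p∪q⁻ (p ─ R) T y∈p′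
  ...   | inj₁ y∈p─R = x∈p∧x∉q⇒x∈p─q (x∈p∩q⁺ (p─q⊆p p R y∈p─R , y∈q)) (x∈p─q⇒x∉q y∈p─R)
  ...   | inj₂ y∈T   = contradiction y∈T (disjoint⁻ p∪q#T (q⊆p∪q p q y∈q))
  ∣p′∩q∣+r≤∣p∩q∣ : ∣ ((p ─ R) ∪ T) ∩ q ∣ + r ≤ ∣ p ∩ q ∣
  ∣p′∩q∣+r≤∣p∩q∣ = begin
    ∣ ((p ─ R) ∪ T) ∩ q ∣ + r  ≤⟨ +-monoˡ-≤ r (p⊆q⇒∣p∣≤∣q∣ p′∩q⊆p∩q─R) ⟩
    ∣ (p ∩ q) ─ R ∣ + r        ≡⟨ cong (∣ (p ∩ q) ─ R ∣ +_) ∣R∣≡r ⟨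
    ∣ (p ∩ q) ─ R ∣ + ∣ R ∣    ≡⟨ ∣p─q∣+∣q∣≡∣p∣ R⊆p∩q ⟩
    ∣ p ∩ q ∣                  ∎
    where open ≤-Reasoning

-- Subsets of a given size

SizedSubset : ℕ → ℕ → Set
SizedSubset m k = Σ (Subset m) λ p → ∣ p ∣ ≡ k

SizedSubset-≡ : ∀ {m k} {A B : SizedSubset m k} → proj₁ A ≡ proj₁ B → A ≡ B
SizedSubset-≡ {A = p , ∣p∣≡k} {B = .p , ∣p∣≡k′} refl = cong (p ,_) (≡-irrelevant ∣p∣≡k ∣p∣≡k′)

SizedSubset-suc↔ : ∀ {m k} → SizedSubset (suc m) (suc k) ↔ (SizedSubset m k ⊎ SizedSubset m (suc k))
SizedSubset-suc↔ {m} {k} = mk↔ₛ′ uncons cons uncons∘cons cons∘uncons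
  where
  uncons : SizedSubset (suc m) (suc k) → SizedSubset m k ⊎ SizedSubset m (suc k)
  uncons (inside  ∷ p , ∣p∣≡k) = inj₁ (p , suc-injective ∣p∣≡k)
  uncons (outside ∷ p , ∣p∣≡k) = inj₂ (p , ∣p∣≡k)
  cons : SizedSubset m k ⊎ SizedSubset m (suc k) → SizedSubset (suc m) (suc k)
  cons (inj₁ (p , ∣p∣≡k)) = inside ∷ p , cong suc ∣p∣≡k
  cons (inj₂ (p , ∣p∣≡k)) = outside ∷ p , ∣p∣≡k
  uncons∘cons : ∀ A → uncons (cons A) ≡ A
  uncons∘cons (inj₁ A) = cong inj₁ (SizedSubset-≡ refl)
  uncons∘cons (inj₂ A) = refl
  cons∘uncons : ∀ A → cons (uncons A) ≡ A
  cons∘uncons (inside  ∷ p , _) = SizedSubset-≡ refl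
  cons∘uncons (outside ∷ p , _) = refl

SizedSubset↔Fin[C] : ∀ m k → SizedSubset m k ↔ Fin (m C k)
SizedSubset↔Fin[C] zero zero =
  mk↔ₛ′ (λ _ → zero) (λ _ → [] , refl) (λ { zero → refl }) (λ { ([] , refl) → refl })
SizedSubset↔Fin[C] zero (suc k) = mk↔ₛ′ (λ { ([] , ()) }) (λ ()) (λ ()) (λ { ([] , ()) })
SizedSubset↔Fin[C] (suc m) zero = ↔-trans drop-outside (SizedSubset↔Fin[C] m zero)
  where
  drop-outside : SizedSubset (suc m) zero ↔ SizedSubset m zero
  drop-outside = mk↔ₛ′ (λ { (outside ∷ p , ∣p∣≡0) → p , ∣p∣≡0 }) (λ (p , ∣p∣≡0) → outside ∷ p , ∣p∣≡0)
                       (λ _ → refl) (λ { (outside ∷ p , _) → refl })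
SizedSubset↔Fin[C] (suc m) (suc k) =
  ↔-trans SizedSubset-suc↔
  (↔-trans (SizedSubset↔Fin[C] m k ⊎-↔ SizedSubset↔Fin[C] m (suc k))
  (↔-trans (↔-sym +↔⊎)
           (subst (λ j → Fin (m C k + m C suc k) ↔ Fin j) (nCk+nC[k+1]≡[n+1]C[k+1] m k) ↔-refl)))

mC[k]≤[1+m]C[k] : ∀ m k → m C k ≤ suc m C k
mC[k]≤[1+m]C[k] m zero    = ≤-refl
mC[k]≤[1+m]C[k] m (suc k) = subst (m C suc k ≤_) (nCk+nC[k+1]≡[n+1]C[k+1] m k) (m≤n+m _ _)

C-monoˡ-≤ : ∀ {m m′} k → m ≤ m′ → m C k ≤ m′ C k
C-monoˡ-≤ k m≤m′ = go (≤⇒≤′ m≤m′)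
  where
  go : ∀ {m m′} → m ≤′ m′ → m C k ≤ m′ C k
  go ≤′-refl         = ≤-refl
  go (≤′-step m≤′m′) = ≤-trans (go m≤′m′) (mC[k]≤[1+m]C[k] _ k)

-- Walks

infixr 5 _◅_

data Walk (H : Graph) : ℕ → V H → V H → Set where
  []  : ∀ {x} → Walk H 0 x x
  _◅_ : ∀ {ℓ x y z} → E H x y → Walk H ℓ y z → Walk H (suc ℓ) x z

module _ {H : Graph} where

  vertex : ∀ {ℓ x y} → Walk H ℓ x y → ℕ → V H
  vertex {x = x} []      _       = x
  vertex {x = x} (_ ◅ _) zero    = x
  vertex         (_ ◅ w) (suc p) = vertex w p

  vertex-0 : ∀ {ℓ x y} (w : Walk H ℓ x y) → vertex w 0 ≡ x
  vertex-0 []      = refl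
  vertex-0 (_ ◅ _) = refl

  vertex-ℓ : ∀ {ℓ x y} (w : Walk H ℓ x y) → vertex w ℓ ≡ y
  vertex-ℓ []      = refl
  vertex-ℓ (_ ◅ w) = vertex-ℓ w

  vertex-edge : ∀ {ℓ x y p} (w : Walk H ℓ x y) → p < ℓ → E H (vertex w p) (vertex w (suc p))
  vertex-edge {p = zero}  (e ◅ w) _         = subst (E H _) (sym (vertex-0 w)) e
  vertex-edge {p = suc p} (_ ◅ w) (s≤s p<ℓ) = vertex-edge w p<ℓ

  infixr 5 _◅◅_

  _◅◅_ : ∀ {ℓ ℓ′ x y z} → Walk H ℓ x y → Walk H ℓ′ y z → Walk H (ℓ + ℓ′) x z
  []      ◅◅ w′ = w′
  (e ◅ w) ◅◅ w′ = e ◅ (w ◅◅ w′)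

  tabulate : ∀ {ℓ} (f : ℕ → V H) → (∀ {p} → p < ℓ → E H (f p) (f (suc p))) → Walk H ℓ (f 0) (f ℓ)
  tabulate {zero}  f _    = []
  tabulate {suc ℓ} f edge = edge (s≤s z≤n) ◅ tabulate (λ p → f (suc p)) (λ p<ℓ → edge (s≤s p<ℓ))

Walk-map : ∀ {H K ℓ x y} (h : Hom H K) → Walk H ℓ x y → Walk K ℓ (proj₁ h x) (proj₁ h y)
Walk-map h []      = []
Walk-map h (e ◅ w) = proj₂ h _ _ e ◅ Walk-map h w

-- Walks in Kneser graphs

-- Odd lengths are written 1 + k * 2 so that 1 + suc k * 2 reduces to suc (suc (1 + k * 2)).
odd-walk-overlap : ∀ {m n} k {A B : V (KG m n)} → Walk (KG m n) (1 + k * 2) A B →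
                   ∣ proj₁ A ∩ proj₁ B ∣ + k * (n + n) ≤ k * m
odd-walk-overlap zero (a#b ◅ []) = ≤-reflexive (trans (+-identityʳ _) (Disjoint⇒∣p∩q∣≡0 a#b))
odd-walk-overlap {m} {n} (suc k) {a , _} {b , _}
                 (_◅_ {y = x , ∣x∣≡n} a#x (_◅_ {y = a′ , ∣a′∣≡n} x#a′ w)) = begin
  ∣ a ∩ b ∣ + ((n + n) + k * (n + n))   ≡⟨ +-assoc ∣ a ∩ b ∣ _ _ ⟨
  ∣ a ∩ b ∣ + (n + n) + k * (n + n)     ≤⟨ +-monoˡ-≤ (k * (n + n)) two-steps ⟩
  ∣ a′ ∩ b ∣ + m + k * (n + n)          ≡⟨ xy∙z≈xz∙y ∣ a′ ∩ b ∣ m _ ⟩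
  ∣ a′ ∩ b ∣ + k * (n + n) + m          ≤⟨ +-monoˡ-≤ m (odd-walk-overlap k w) ⟩
  k * m + m                             ≡⟨ +-comm (k * m) m ⟩
  m + k * m                             ∎
  where
  open ≤-Reasoning
  two-steps : ∣ a ∩ b ∣ + (n + n) ≤ ∣ a′ ∩ b ∣ + m
  two-steps = subst (λ j → ∣ a ∩ b ∣ + j ≤ ∣ a′ ∩ b ∣ + m) (cong₂ _+_ ∣x∣≡n ∣a′∣≡n)
                (∣p∩r∣+∣x∣+∣q∣≤∣q∩r∣+m b a#x x#a′)

odd-walk-ends-distinct : ∀ {m n} s {A B : V (KG m n)} → s * m < n + s * (n + n) →
                         Walk (KG m n) (1 + s * 2) A B → A ≢ B
odd-walk-ends-distinct {m} {n} s {A , ∣A∣≡n} short w refl = <⇒≱ short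
  (subst (λ j → j + s * (n + n) ≤ s * m) (trans (cong ∣_∣ (∩-idem A)) ∣A∣≡n) (odd-walk-overlap s w))

≢⇒∣A∩B∣<n : ∀ {m n} {A B : V (KG m n)} → A ≢ B → ∣ proj₁ A ∩ proj₁ B ∣ < n
≢⇒∣A∩B∣<n {A = a , ∣a∣≡n} {B = b , ∣b∣≡n} A≢B = subst (∣ a ∩ b ∣ <_) ∣a∣≡n
  (∣p∣≡∣q∣∧p≢q⇒∣p∩q∣<∣p∣ (trans ∣a∣≡n (sym ∣b∣≡n)) (λ a≡b → A≢B (SizedSubset-≡ a≡b)))

m<n⇒m≤n∸1 : ∀ {m n} → m < n → m ≤ n ∸ 1
m<n⇒m≤n∸1 (s≤s m≤n) = m≤n

m≤n+o⇒m≤n⊓m+o : ∀ {m n o} → m ≤ n + o → m ≤ n ⊓ m + o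
m≤n+o⇒m≤n⊓m+o {m} {n} {o} m≤n+o = subst (m ≤_) (sym (+-distribʳ-⊓ o n m)) (⊓-glb m≤n+o (m≤m+n m o))

module _ {m n i : ℕ} (m≡2n+i : m ≡ n + n + i) where

  i≤∣∁a∪b∣ : ∀ (A B : V (KG m n)) → i ≤ ∣ ∁ (proj₁ A ∪ proj₁ B) ∣
  i≤∣∁a∪b∣ (a , ∣a∣≡n) (b , ∣b∣≡n) = begin
    i                      ≡⟨ m+n∸m≡n (n + n) i ⟨
    n + n + i ∸ (n + n)    ≡⟨ cong (_∸ (n + n)) m≡2n+i ⟨
    m ∸ (n + n)            ≤⟨ ∸-monoʳ-≤ m ∣a∪b∣≤n+n ⟩
    m ∸ ∣ a ∪ b ∣          ≡⟨ ∣∁p∣≡n∸∣p∣ (a ∪ b) ⟨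
    ∣ ∁ (a ∪ b) ∣          ∎
    where
    open ≤-Reasoning
    ∣a∪b∣≤n+n : ∣ a ∪ b ∣ ≤ n + n
    ∣a∪b∣≤n+n = subst₂ (λ j k → ∣ a ∪ b ∣ ≤ j + k) ∣a∣≡n ∣b∣≡n (∣p∪q∣≤∣p∣+∣q∣ a b)

  -- Swap r = i ⊓ ∣ a ∩ b ∣ common elements of a and b for r elements outside a ∪ b; the result c
  -- satisfies ∣ a ∪ c ∣ ≤ n + i, which leaves room for an n-set x disjoint from both a and c.
  two-steps-towards : ∀ k (A B : V (KG m n)) → ∣ proj₁ A ∩ proj₁ B ∣ ≤ suc k * i →
                      Σ (V (KG m n)) λ A′ → Walk (KG m n) 2 A A′ × ∣ proj₁ A′ ∩ proj₁ B ∣ ≤ k * i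
  two-steps-towards k A@(a , ∣a∣≡n) B@(b , _) ∣a∩b∣≤
    with exchange a b (m⊓n≤n i ∣ a ∩ b ∣) (≤-trans (m⊓n≤m i _) (i≤∣∁a∪b∣ A B))
  ... | c , ∣c∣≡∣a∣ , ∣a∪c∣≤∣a∣+r , ∣c∩b∣+r≤∣a∩b∣
    with disjoint-of-size (a ∪ c) {n} n+∣a∪c∣≤m
    where
    n+∣a∪c∣≤m : n + ∣ a ∪ c ∣ ≤ m
    n+∣a∪c∣≤m = begin
      n + ∣ a ∪ c ∣   ≤⟨ +-monoʳ-≤ n (≤-trans ∣a∪c∣≤∣a∣+r (+-mono-≤ (≤-reflexive ∣a∣≡n) (m⊓n≤m i _))) ⟩
      n + (n + i)     ≡⟨ +-assoc n n i ⟨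
      n + n + i       ≡⟨ m≡2n+i ⟨
      m               ∎
      where open ≤-Reasoning
  ... | x , ∣x∣≡n , a∪c#x = A′ , _◅_ {y = X} A#X (X#A′ ◅ []) , +-cancelˡ-≤ r ∣ c ∩ b ∣ (k * i) r+∣c∩b∣≤r+ki
    where
    A′ X : V (KG m n)
    A′ = c , trans ∣c∣≡∣a∣ ∣a∣≡n
    X = x , ∣x∣≡n
    A#X : E (KG m n) A X
    A#X = Disjoint-mono (p⊆p∪q c) ⊆-refl a∪c#x
    X#A′ : E (KG m n) X A′
    X#A′ = Disjoint-sym (Disjoint-mono (q⊆p∪q a c) ⊆-refl a∪c#x)
    r = i ⊓ ∣ a ∩ b ∣
    r+∣c∩b∣≤r+ki : r + ∣ c ∩ b ∣ ≤ r + k * i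
    r+∣c∩b∣≤r+ki = begin
      r + ∣ c ∩ b ∣  ≡⟨ +-comm r _ ⟩
      ∣ c ∩ b ∣ + r  ≤⟨ ∣c∩b∣+r≤∣a∩b∣ ⟩
      ∣ a ∩ b ∣      ≤⟨ m≤n+o⇒m≤n⊓m+o {n = i} ∣a∩b∣≤ ⟩
      r + k * i      ∎
      where open ≤-Reasoning

  overlap⇒odd-walk : ∀ k (A B : V (KG m n)) → ∣ proj₁ A ∩ proj₁ B ∣ ≤ k * i → Walk (KG m n) (1 + k * 2) A B
  overlap⇒odd-walk zero    A B ∣a∩b∣≤0 = ∣p∣≡0⇒Empty (n≤0⇒n≡0 ∣a∩b∣≤0) ◅ []
  overlap⇒odd-walk (suc k) A B ∣a∩b∣≤ with two-steps-towards k A B ∣a∩b∣≤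
  ... | A′ , A⇝A′ , ∣a′∩b∣≤ = A⇝A′ ◅◅ overlap⇒odd-walk k A′ B ∣a′∩b∣≤

-- Subdivisions and colourings

module _ (G : FinGraph) (L : ℕ) where

  subdivision-walk : ∀ {a b} → EdgeLt G a b → Walk (Subdiv G (suc L)) (suc L) (orig a) (orig b)
  subdivision-walk {a} {b} e =
    subst (Walk (Subdiv G (suc L)) (suc L) (orig a)) path-end (tabulate path path-edge)
    where
    path : ℕ → SubV G (suc L)
    path zero = orig a
    path (suc p) with p <? L
    ... | yes p<L = mid a b e (fromℕ< p<L)
    ... | no  _   = orig b
    path-end : path (suc L) ≡ orig b
    path-end with L <? L
    ... | yes L<L = contradiction L<L (n≮n L)
    ... | no  _   = refl
    path-step : ∀ {p} → p < suc L → SubE G (suc L) (path p) (path (suc p))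
    path-step {zero} _ with 0 <? L
    ... | yes 0<L = start a b e (fromℕ< 0<L) (toℕ-fromℕ< 0<L)
    ... | no  0≮L = direct a b e (cong suc (n≤0⇒n≡0 (≮⇒≥ 0≮L)))
    path-step {suc p} (s≤s p<L) with p <? L
    ... | no  p≮L = contradiction p<L p≮L
    ... | yes p<L′ with suc p <? L
    ...   | yes 1+p<L = step a b e (fromℕ< p<L′) (fromℕ< 1+p<L)
                          (trans (toℕ-fromℕ< 1+p<L) (cong suc (sym (toℕ-fromℕ< p<L′))))
    ...   | no  1+p≮L = finish a b e (fromℕ< p<L′) (trans (cong suc (toℕ-fromℕ< p<L′)) (≤∧≮⇒≡ p<L 1+p≮L))
    path-edge : ∀ {p} → p < suc L → E (Subdiv G (suc L)) (path p) (path (suc p))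
    path-edge p<1+L = inj₁ (path-step p<1+L)

  Subdiv-hom : ∀ {H} → (∀ {x y} → E H x y → E H y x) → (h : Fin (N G) → V H) →
               (∀ {a b} → EdgeLt G a b → Walk H (suc L) (h a) (h b)) → Hom (Subdiv G (suc L)) H
  Subdiv-hom {H} E-sym h walk = f , λ { _ _ (inj₁ xy) → f-edge xy ; _ _ (inj₂ yx) → E-sym (f-edge yx) }
    where
    f : SubV G (suc L) → V H
    f (orig v)      = h v
    f (mid a b e k) = vertex (walk e) (suc (toℕ k))
    edge-at : ∀ {a b x y p} (e : EdgeLt G a b) → p < suc L →
              vertex (walk e) p ≡ x → vertex (walk e) (suc p) ≡ y → E H x y
    edge-at e p<1+L refl refl = vertex-edge (walk e) p<1+L
    f-edge : ∀ {x y} → SubE G (suc L) x y → E H (f x) (f y)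
    f-edge (direct u v e 1+L≡1) =
      edge-at e (s≤s z≤n) (vertex-0 (walk e))
              (trans (cong (λ j → vertex (walk e) (suc j)) (sym (suc-injective 1+L≡1))) (vertex-ℓ (walk e)))
    f-edge (start u v e k k≡0) =
      edge-at e (s≤s z≤n) (vertex-0 (walk e)) (cong (λ j → vertex (walk e) (suc j)) (sym k≡0))
    f-edge (step u v e k k′ k′≡1+k) =
      edge-at e (s≤s (toℕ<n k)) refl (cong (λ j → vertex (walk e) (suc j)) (sym k′≡1+k))
    f-edge (finish u v e k 1+k≡L) =
      edge-at e (s≤s (toℕ<n k)) refl (trans (cong (λ j → vertex (walk e) (suc j)) 1+k≡L) (vertex-ℓ (walk e)))

EdgeLt⇒adj : ∀ G {a b} → EdgeLt G a b → adj G a b ≡ true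
EdgeLt⇒adj G {a} {b} e with adj G a b
... | true  = refl
... | false = ⊥-elim e

adj⇒EdgeLt : ∀ G {a b} → adj G a b ≡ true → toℕ a < toℕ b → EdgeLt G a b
adj⇒EdgeLt G ab a<b = subst (λ β → T (β ∧ _)) (sym ab) (<⇒<ᵇ a<b)

orient : ∀ G {u v} → adj G u v ≡ true → EdgeLt G u v ⊎ EdgeLt G v u
orient G {u} {v} uv with <-cmp (toℕ u) (toℕ v)
... | tri< u<v _ _ = inj₁ (adj⇒EdgeLt G uv u<v)
... | tri> _ _ v<u = inj₂ (adj⇒EdgeLt G (trans (FinGraph.sym G v u) uv) v<u)
... | tri≈ _ u≡v _ = contradiction (trans (sym uu) (irref G u)) λ ()
  where
  uu : adj G u u ≡ true
  uu = subst (λ w → adj G u w ≡ true) (sym (toℕ-injective u≡v)) uv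

Complete-weaken : ∀ {H k k′} → k ≤ k′ → Hom H (Complete k) → Hom H (Complete k′)
Complete-weaken k≤k′ (c , c-proper) =
  (λ x → inject≤ (c x) k≤k′) , λ x y xy same → c-proper x y xy (inject≤-injective k≤k′ k≤k′ _ _ same)

colouring-of-subdivision : ∀ (G : FinGraph) s {m n} → s * m < n + s * (n + n) →
                           Hom (Subdiv G (1 + s * 2)) (KG m n) → Hom (toGraph G) (Complete (m C n))
colouring-of-subdivision G s {m} {n} short h@(f , _) = colour , colour-proper
  where
  open Injection (↔⇒↣ (SizedSubset↔Fin[C] m n))
  colour : Fin (N G) → Fin (m C n)
  colour v = to (f (orig v))
  ends-distinct : ∀ {a b} → EdgeLt G a b → f (orig a) ≢ f (orig b)
  ends-distinct e = odd-walk-ends-distinct s short (Walk-map h (subdivision-walk G (s * 2) e))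
  colour-proper : ∀ u v → adj G u v ≡ true → colour u ≢ colour v
  colour-proper u v uv same with orient G uv
  ... | inj₁ e = ends-distinct e (injective same)
  ... | inj₂ e = ends-distinct e (sym (injective same))

subdivision-of-colouring : ∀ (G : FinGraph) s {m n i} → m ≡ n + n + i → n ∸ 1 ≤ s * i →
                           Hom (toGraph G) (Complete (m C n)) → Hom (Subdiv G (1 + s * 2)) (KG m n)
subdivision-of-colouring G s {m} {n} {i} m≡2n+i n∸1≤si (c , c-proper) =
  Subdiv-hom G (s * 2) Disjoint-sym D walk
  where
  open Injection (↔⇒↣ (↔-sym (SizedSubset↔Fin[C] m n)))
  D : Fin (N G) → V (KG m n)
  D v = to (c v)
  walk : ∀ {a b} → EdgeLt G a b → Walk (KG m n) (1 + s * 2) (D a) (D b)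
  walk {a} {b} e = overlap⇒odd-walk m≡2n+i s (D a) (D b) (≤-trans (m<n⇒m≤n∸1 (≢⇒∣A∩B∣<n Da≢Db)) n∸1≤si)
    where
    Da≢Db : D a ≢ D b
    Da≢Db eq = c-proper a b (EdgeLt⇒adj G e) (injective eq)

m≤n+n+i⇒s*m<n+s*[n+n] : ∀ {s i n m} → 1 ≤ n → s * i ≡ n ∸ 1 → m ≤ n + n + i → s * m < n + s * (n + n)
m≤n+n+i⇒s*m<n+s*[n+n] {s} {i} {n@(suc n-1)} {m} _ si≡n-1 m≤n+n+i = begin-strict
  s * m                 ≤⟨ *-monoʳ-≤ s m≤n+n+i ⟩
  s * (n + n + i)       ≡⟨ *-distribˡ-+ s (n + n) i ⟩
  s * (n + n) + s * i   ≡⟨ cong (s * (n + n) +_) si≡n-1 ⟩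
  s * (n + n) + n-1     <⟨ +-monoʳ-< (s * (n + n)) (n<1+n n-1) ⟩
  s * (n + n) + n       ≡⟨ +-comm _ n ⟩
  n + s * (n + n)       ∎
  where open ≤-Reasoning

2*m+1≡1+m*2 : ∀ m → 2 * m + 1 ≡ 1 + m * 2
2*m+1≡1+m*2 m = trans (+-comm (2 * m) 1) (cong suc (*-comm 2 m))

theorem4 : (G : FinGraph) → NonBipartite (toGraph G) →
           (i n s : ℕ) → 1 ≤ i → 1 ≤ n → 1 ≤ s → i * s ≡ n ∸ 1 →
           (MultiChromLe (Subdiv G (2 * s + 1)) n (2 * n + i)
             ⇔ ChromLe (toGraph G) ((2 * n + i) C n))
theorem4 G _ i n s _ 1≤n _ is≡n∸1 rewrite 2*m+1≡1+m*2 s = mk⇔ to-colouring from-colouring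
  where
  M≡2n+i : 2 * n + i ≡ n + n + i
  M≡2n+i = cong (λ j → n + j + i) (+-identityʳ n)
  si≡n∸1 : s * i ≡ n ∸ 1
  si≡n∸1 = trans (*-comm s i) is≡n∸1
  to-colouring : MultiChromLe (Subdiv G (1 + s * 2)) n (2 * n + i) → ChromLe (toGraph G) ((2 * n + i) C n)
  to-colouring (m , m≤M , _ , h) = m C n , C-monoˡ-≤ n m≤M ,
    colouring-of-subdivision G s (m≤n+n+i⇒s*m<n+s*[n+n] {s} 1≤n si≡n∸1 (subst (m ≤_) M≡2n+i m≤M)) h
  from-colouring : ChromLe (toGraph G) ((2 * n + i) C n) → MultiChromLe (Subdiv G (1 + s * 2)) n (2 * n + i)
  from-colouring (k , k≤ , c) = 2 * n + i , ≤-refl , subst (n + n ≤_) (sym M≡2n+i) (m≤m+n (n + n) i) ,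
    subdivision-of-colouring G s M≡2n+i (≤-reflexive (sym si≡n∸1)) (Complete-weaken k≤ c)
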